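{- Let $u$ be a vertex of a graph $G=(V,E)$. Then $u$ is avoidable in $G$ if and only if $u$ is avoidable in the contracted graph $G_u(X,C)$.
   Context: All graphs are finite, simple and undirected. A vertex $v$ of a graph $G$ is avoidable if every induced path on three vertices with middle vertex $v$ is contained in an induced cycle of $G$. Contracting a vertex set $S$ inducing a connected subgraph means replacing $S$ by a single new vertex $w$ with $N(w)=N(S)$, where $N(S)$ is the set of vertices outside $S$ having a neighbor in $S$. For a vertex $u$, $G_u$ is the graph obtained from $G$ by contracting every connected component of $G-N_G[u]$ into a single vertex; its vertices other than $u$ are partitioned into $X=N_G(u)$ and the set $C$ of contracted vertices, and this graph is denoted $G_u(X,C)$. -}

module Defs where

open import Data.Nat using (ℕ; zero; suc; _≥_)
open import Data.Fin using (Fin; toℕ; _≤_)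
open import Data.Bool using (Bool; true; false; T)
open import Data.List using (List; length; lookup)
open import Data.List.Membership.Propositional using (_∈_)
open import Data.List.Relation.Unary.All using (All)
open import Data.List.Relation.Unary.Unique.Propositional using (Unique)
open import Data.Product using (Σ; ∃; _×_)
open import Data.Sum using (_⊎_)
open import Data.Unit using (⊤)
open import Relation.Nullary using (¬_)
open import Relation.Binary.PropositionalEquality using (_≡_; _≢_)

record Graph (n : ℕ) : Set where
  field
    adj    : Fin n → Fin n → Bool
    sym    : ∀ x y → adj x y ≡ adj y x
    irrefl : ∀ x → adj x x ≡ false
open Graph public

-- Generic notions for a graph whose vertex set is a subset Vt of Fin n
-- and whose (symmetric) edge relation is E.

CycAdj : {k : ℕ} → Fin k → Fin k → Set
CycAdj {k} i j =
  suc (toℕ i) ≡ toℕ j ⊎ suc (toℕ j) ≡ toℕ i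
  ⊎ (toℕ i ≡ 0 × suc (toℕ j) ≡ k) ⊎ (toℕ j ≡ 0 × suc (toℕ i) ≡ k)

InducedCycle : {n : ℕ} → (Fin n → Set) → (Fin n → Fin n → Set) → List (Fin n) → Set
InducedCycle Vt E cs =
  length cs ≥ 3 × Unique cs × All Vt cs ×
  (∀ i j → (E (lookup cs i) (lookup cs j) → CycAdj i j) × (CycAdj i j → E (lookup cs i) (lookup cs j)))

Avoidable : {n : ℕ} → (Fin n → Set) → (Fin n → Fin n → Set) → Fin n → Set
Avoidable {n} Vt E v =
  ∀ (x y : Fin n) → Vt x → Vt y → E x v → E v y → x ≢ y → ¬ E x y →
  ∃ λ cs → InducedCycle Vt E cs × x ∈ cs × v ∈ cs × y ∈ cs

FullV : {n : ℕ} → Fin n → Set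
FullV _ = ⊤

Edge : {n : ℕ} → Graph n → Fin n → Fin n → Set
Edge G a b = T (adj G a b)

-- The contracted graph G_u(X, C).  Each connected component S of G - N[u]
-- is represented by its least vertex (w.r.t. the order of Fin n).

module _ {n : ℕ} (G : Graph n) (u : Fin n) where

  ClosedNbhd : Fin n → Set
  ClosedNbhd w = w ≡ u ⊎ Edge G u w

  Outside : Fin n → Set
  Outside w = ¬ ClosedNbhd w

  data Reach : Fin n → Fin n → Set where
    here : ∀ {a} → Outside a → Reach a a
    step : ∀ {a b c} → Reach a b → Edge G b c → Outside c → Reach a c

  Rep : Fin n → Set
  Rep w = Outside w × (∀ w' → Reach w w' → w ≤ w')

  VertU : Fin n → Set
  VertU w = w ≡ u ⊎ Edge G u w ⊎ Rep w

  -- edges of G_u: edges of G inside N[u], plus x ~ S whenever x ∈ N(S)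
  EdgeU : Fin n → Fin n → Set
  EdgeU a b =
    (ClosedNbhd a × ClosedNbhd b × Edge G a b)
    ⊎ (Rep a × Edge G u b × (∃ λ z → Reach a z × Edge G z b))
    ⊎ (Rep b × Edge G u a × (∃ λ z → Reach b z × Edge G a z))

-- Let x, y be non-adjacent neighbours of u. An induced cycle through x – u – y closes up
-- through vertices non-adjacent to u, so x and y have neighbours in a common component S of
-- G − N[u]; conversely a path through such an S shortcuts to an induced one. The same
-- condition characterises G_u, whose induced cycles through x – u – y are exactly
-- x – u – y – S, since no two contracted vertices are adjacent. Both sides of the
-- equivalence therefore reduce to the same condition on G.

module Submission where

open import Defs hiding (sym)
open import Data.Bool using (T)
open import Data.Empty using (⊥-elim)
open import Data.Unit using (tt)
open import Data.Fin as Fin using (Fin; zero; suc; toℕ; fromℕ; inject₁; lower₁; _≤_)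
open import Data.Fin.Induction using (<-weakInduction; <-weakInduction-startingFrom)
open import Data.Fin.Properties
  using ( toℕ-injective; toℕ<n; toℕ-fromℕ; ≤fromℕ; toℕ-lower₁; inject₁-lower₁; lower₁-inject₁′
        ; toℕ-inject₁-≢ )
open import Data.List using (List; []; _∷_; length; lookup; allFin)
open import Data.List.Membership.Propositional using (_∈_)
open import Data.List.Membership.Propositional.Properties using (∈-lookup; ∈-allFin)
open import Data.List.Relation.Unary.All as All using (All; []; _∷_)
open import Data.List.Relation.Unary.All.Properties.Core using (¬Any⇒All¬)
open import Data.List.Relation.Unary.Any as Any using (Any; here; there; any?)
open import Data.List.Relation.Unary.Any.Properties using (lookup-index)
open import Data.List.Relation.Unary.AllPairs using ([]; _∷_)
open import Data.List.Relation.Unary.Unique.Propositional using (Unique)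
open import Data.Nat as ℕ using (ℕ; zero; suc; z≤n; s≤s)
open import Data.Nat.Properties using (suc-injective; <⇒≢)
open import Data.Product using (∃; ∃₂; _×_; _,_; proj₁; proj₂)
open import Data.Sum as Sum using (_⊎_; inj₁; inj₂)
open import Function using (_∘_)
open import Function.Bundles using (_⇔_; mk⇔; Equivalence)
open import Function.Construct.Composition using (_⇔-∘_)
open import Relation.Nullary using (¬_; Dec; yes; no; contradiction)
open import Relation.Nullary.Decidable using (_⊎-dec_; _×-dec_; ¬?; map′; T?)
open import Relation.Binary.PropositionalEquality
  using (_≡_; _≢_; refl; sym; trans; cong; subst; module ≡-Reasoning)

lookup-injective : ∀ {A : Set} {xs : List A} → Unique xs →
                   ∀ {i j} → lookup xs i ≡ lookup xs j → i ≡ j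
lookup-injective (_ ∷ _)     {zero}  {zero}  _  = refl
lookup-injective (x∉ ∷ _)    {zero}  {suc j} eq = contradiction eq (All.lookup x∉ (∈-lookup j))
lookup-injective (x∉ ∷ _)    {suc i} {zero}  eq = contradiction (sym eq) (All.lookup x∉ (∈-lookup i))
lookup-injective (_ ∷ uniq)  {suc i} {suc j} eq = cong suc (lookup-injective uniq eq)

next : ∀ {k} → Fin (suc k) → Fin (suc k)
next {k} i with k ℕ.≟ toℕ i
... | yes _   = zero
... | no k≢i  = suc (lower₁ i k≢i)

prev : ∀ {k} → Fin (suc k) → Fin (suc k)
prev {k}     zero    = fromℕ k
prev {suc k} (suc i) = inject₁ i

next-view : ∀ {k} (i : Fin (suc k)) → (toℕ i ≡ k × next i ≡ zero) ⊎ toℕ (next i) ≡ suc (toℕ i)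
next-view {k} i with k ℕ.≟ toℕ i
... | yes k≡i = inj₁ (sym k≡i , refl)
... | no k≢i  = inj₂ (cong suc (toℕ-lower₁ i k≢i))

next-fromℕ : ∀ k → next (fromℕ k) ≡ zero
next-fromℕ k with k ℕ.≟ toℕ (fromℕ k)
... | yes _   = refl
... | no k≢k  = contradiction (sym (toℕ-fromℕ k)) k≢k

next-inject₁ : ∀ {k} (i : Fin k) → next (inject₁ i) ≡ suc i
next-inject₁ {k} i with k ℕ.≟ toℕ (inject₁ i)
... | yes k≡i = contradiction k≡i (toℕ-inject₁-≢ i)
... | no k≢i  = cong suc (lower₁-inject₁′ i k≢i)

next-prev : ∀ {k} (i : Fin (suc k)) → next (prev i) ≡ i
next-prev {k}     zero    = next-fromℕ k
next-prev {suc k} (suc i) = next-inject₁ i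

prev-next : ∀ {k} (i : Fin (suc k)) → prev (next i) ≡ i
prev-next {k} i with k ℕ.≟ toℕ i
prev-next {k}     i    | yes k≡i = toℕ-injective (trans (toℕ-fromℕ k) k≡i)
prev-next {zero}  zero | no 0≢0  = contradiction refl 0≢0
prev-next {suc k} i    | no k≢i  = inject₁-lower₁ i k≢i

next-injective : ∀ {k} {i j : Fin (suc k)} → next i ≡ next j → i ≡ j
next-injective {i = i} {j} eq = begin
  i              ≡⟨ prev-next i ⟨
  prev (next i)  ≡⟨ cong prev eq ⟩
  prev (next j)  ≡⟨ prev-next j ⟩
  j              ∎
  where open ≡-Reasoning

next-induction : ∀ {k} (Q : Fin (suc k) → Set) {p} → Q p → (∀ j → Q j → Q (next j)) → ∀ j → Q j
next-induction {k} Q {p} Qp Q-next = <-weakInduction Q Q-zero Q-suc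
  where
  Q-suc : ∀ i → Q (inject₁ i) → Q (suc i)
  Q-suc i q = subst Q (next-inject₁ i) (Q-next _ q)
  Q-zero : Q zero
  Q-zero = subst Q (next-fromℕ k) (Q-next _ (<-weakInduction-startingFrom Q Qp Q-suc (≤fromℕ p)))

CycAdj-sym : ∀ {k} {i j : Fin k} → CycAdj i j → CycAdj j i
CycAdj-sym (inj₁ p)                = inj₂ (inj₁ p)
CycAdj-sym (inj₂ (inj₁ p))         = inj₁ p
CycAdj-sym (inj₂ (inj₂ (inj₁ p)))  = inj₂ (inj₂ (inj₂ p))
CycAdj-sym (inj₂ (inj₂ (inj₂ p)))  = inj₂ (inj₂ (inj₁ p))

CycAdj-next : ∀ {k} (i : Fin (suc k)) → CycAdj i (next i)
CycAdj-next i with next-view i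
... | inj₁ (i≡k , next≡0) = inj₂ (inj₂ (inj₂ (cong toℕ next≡0 , cong suc i≡k)))
... | inj₂ next≡1+i       = inj₁ (sym next≡1+i)

next-of-successor : ∀ {k} {i j : Fin (suc k)} → suc (toℕ i) ≡ toℕ j → next i ≡ j
next-of-successor {i = i} {j} 1+i≡j with next-view i
... | inj₁ (i≡k , _) = contradiction (trans (sym 1+i≡j) (cong suc i≡k)) (<⇒≢ (toℕ<n j))
... | inj₂ next≡1+i  = toℕ-injective (trans next≡1+i 1+i≡j)

next-of-last : ∀ {k} {i j : Fin (suc k)} → toℕ j ≡ 0 → suc (toℕ i) ≡ suc k → next i ≡ j
next-of-last {i = i} {j} j≡0 1+i≡1+k with next-view i
... | inj₁ (_ , next≡0) = trans next≡0 (toℕ-injective (sym j≡0))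
... | inj₂ next≡1+i     = contradiction (trans next≡1+i 1+i≡1+k) (<⇒≢ (toℕ<n (next i)))

CycAdj⇒next : ∀ {k} {i j : Fin (suc k)} → CycAdj i j → next i ≡ j ⊎ next j ≡ i
CycAdj⇒next (inj₁ 1+i≡j)                       = inj₁ (next-of-successor 1+i≡j)
CycAdj⇒next (inj₂ (inj₁ 1+j≡i))                = inj₂ (next-of-successor 1+j≡i)
CycAdj⇒next (inj₂ (inj₂ (inj₁ (i≡0 , 1+j≡m)))) = inj₂ (next-of-last i≡0 1+j≡m)
CycAdj⇒next (inj₂ (inj₂ (inj₂ (j≡0 , 1+i≡m)))) = inj₁ (next-of-last j≡0 1+i≡m)

PathAdj : ∀ {m} → Fin m → Fin m → Set
PathAdj i j = suc (toℕ i) ≡ toℕ j ⊎ suc (toℕ j) ≡ toℕ i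

PathAdj⇔PathAdj-suc : ∀ {m} {i j : Fin m} → PathAdj i j ⇔ PathAdj {suc m} (suc i) (suc j)
PathAdj⇔PathAdj-suc = mk⇔ (Sum.map (cong suc) (cong suc)) (Sum.map suc-injective suc-injective)

PathAdj⇔CycAdj-suc : ∀ {m} {i j : Fin m} → PathAdj i j ⇔ CycAdj {suc m} (suc i) (suc j)
PathAdj⇔CycAdj-suc {m} {i} {j} = mk⇔ to from
  where
  to : PathAdj i j → CycAdj {suc m} (suc i) (suc j)
  to (inj₁ 1+i≡j) = inj₁ (cong suc 1+i≡j)
  to (inj₂ 1+j≡i) = inj₂ (inj₁ (cong suc 1+j≡i))
  from : CycAdj {suc m} (suc i) (suc j) → PathAdj i j
  from (inj₁ 1+i≡j)                 = inj₁ (suc-injective 1+i≡j)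
  from (inj₂ (inj₁ 1+j≡i))          = inj₂ (suc-injective 1+j≡i)
  from (inj₂ (inj₂ (inj₁ (() , _))))
  from (inj₂ (inj₂ (inj₂ (() , _))))

end⇔CycAdj-zero : ∀ {m} {j : Fin m} → (toℕ j ≡ 0 ⊎ suc (toℕ j) ≡ m) ⇔ CycAdj {suc m} zero (suc j)
end⇔CycAdj-zero {m} {j} = mk⇔ to from
  where
  to : toℕ j ≡ 0 ⊎ suc (toℕ j) ≡ m → CycAdj {suc m} zero (suc j)
  to (inj₁ j≡0)   = inj₁ (cong suc (sym j≡0))
  to (inj₂ 1+j≡m) = inj₂ (inj₂ (inj₁ (refl , cong suc 1+j≡m)))
  from : CycAdj {suc m} zero (suc j) → toℕ j ≡ 0 ⊎ suc (toℕ j) ≡ m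
  from (inj₁ 1≡1+j)                   = inj₁ (sym (suc-injective 1≡1+j))
  from (inj₂ (inj₁ ()))
  from (inj₂ (inj₂ (inj₁ (_ , 2+j≡1+m)))) = inj₂ (suc-injective 2+j≡1+m)
  from (inj₂ (inj₂ (inj₂ (() , _))))

module Cycles {n : ℕ} (E : Fin n → Fin n → Set)
              (E-sym : ∀ {a b} → E a b → E b a) (E-irrefl : ∀ {a} → ¬ E a a) where

  Touches : Fin n → Fin n → Set
  Touches v z = z ≡ v ⊎ E v z

  CycleThrough : (Fin n → Set) → Fin n → Fin n → Fin n → Set
  CycleThrough Vt x u y = ∃ λ cs → InducedCycle Vt E cs × x ∈ cs × u ∈ cs × y ∈ cs

  data InducedPath : List (Fin n) → Set where
    [-]  : ∀ {v} → InducedPath (v ∷ [])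
    link : ∀ {v w ws} → E v w → All (¬_ ∘ Touches v) ws → InducedPath (w ∷ ws) →
           InducedPath (v ∷ w ∷ ws)

  data Towards (P : Fin n → Set) (x : Fin n) : List (Fin n) → Set where
    [-] : Towards P x (x ∷ [])
    _∷_ : ∀ {v vs} → P v → Towards P x vs → Towards P x (v ∷ vs)

  towards-∈ : ∀ {P x vs} → Towards P x vs → x ∈ vs
  towards-∈ [-]      = here refl
  towards-∈ (_ ∷ tw) = there (towards-∈ tw)

  towards-last : ∀ {P x vs} → Towards P x vs → ∀ j → suc (toℕ j) ≡ length vs → lookup vs j ≡ x
  towards-last [-]           zero    _  = refl
  towards-last (_ ∷ (_ ∷ _)) zero    ()
  towards-last (_ ∷ [-])     zero    ()
  towards-last (_ ∷ tw)      (suc j) eq = towards-last tw j (suc-injective eq)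

  towards-init : ∀ {P x vs} → Towards P x vs → ∀ j → suc (toℕ j) ≢ length vs → P (lookup vs j)
  towards-init [-]      zero    ne = contradiction refl ne
  towards-init (p ∷ _)  zero    _  = p
  towards-init (_ ∷ tw) (suc j) ne = towards-init tw j (ne ∘ cong suc)

  E⇒≢ : ∀ {a b} → E a b → a ≢ b
  E⇒≢ e refl = E-irrefl e

  ¬Touches⇒≢ : ∀ {v z} → ¬ Touches v z → v ≢ z
  ¬Touches⇒≢ far v≡z = far (inj₁ (sym v≡z))

  path-unique : ∀ {vs} → InducedPath vs → Unique vs
  path-unique [-]            = [] ∷ []
  path-unique (link e far p) = (E⇒≢ e ∷ All.map ¬Touches⇒≢ far) ∷ path-unique p

  link-adjacent : ∀ {v w ws} → E v w → All (¬_ ∘ Touches v) ws →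
                  ∀ j → E v (lookup (w ∷ ws) j) ⇔ toℕ j ≡ 0
  link-adjacent e far zero    = mk⇔ (λ _ → refl) (λ _ → e)
  link-adjacent e far (suc j) = mk⇔ (λ e′ → contradiction (inj₂ e′) (All.lookup far (∈-lookup j))) (λ ())

  no-self-adjacency : ∀ {m v} → E v v ⇔ PathAdj {suc m} zero zero
  no-self-adjacency = mk⇔ (⊥-elim ∘ E-irrefl) λ { (inj₁ ()) ; (inj₂ ()) }

  path-adjacent : ∀ {vs} → InducedPath vs → ∀ i j → E (lookup vs i) (lookup vs j) ⇔ PathAdj i j
  path-adjacent {v ∷ []}      [-]          zero zero = no-self-adjacency {m = 0} {v}
  path-adjacent {v ∷ _ ∷ ws}  (link _ _ _) zero zero = no-self-adjacency {m = suc (length ws)} {v}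
  path-adjacent (link e far _) zero    (suc j) =
    mk⇔ (inj₁ ∘ cong suc ∘ sym ∘ to) λ { (inj₁ 1≡1+j) → from (sym (suc-injective 1≡1+j)) ; (inj₂ ()) }
    where open Equivalence (link-adjacent e far j)
  path-adjacent (link e far _) (suc i) zero    =
    mk⇔ (inj₂ ∘ cong suc ∘ sym ∘ to ∘ E-sym)
        λ { (inj₂ 1≡1+i) → E-sym (from (sym (suc-injective 1≡1+i))) ; (inj₁ ()) }
    where open Equivalence (link-adjacent e far i)
  path-adjacent (link _ _ p)   (suc i) (suc j) = PathAdj⇔PathAdj-suc ⇔-∘ path-adjacent p i j

  module _ {u x y : Fin n} {ws : List (Fin n)} (uy : E u y) (ux : E u x)
           (tw : Towards (¬_ ∘ Touches u) x ws) where

    apex-adjacent : ∀ j → E u (lookup (y ∷ ws) j) ⇔ CycAdj {length (u ∷ y ∷ ws)} zero (suc j)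
    apex-adjacent j = end⇔CycAdj-zero ⇔-∘ ends j
      where
      ends : ∀ j → E u (lookup (y ∷ ws) j) ⇔ (toℕ j ≡ 0 ⊎ suc (toℕ j) ≡ length (y ∷ ws))
      ends zero    = mk⇔ (λ _ → inj₁ refl) (λ _ → uy)
      ends (suc j) = mk⇔ to from
        where
        to : E u (lookup ws j) → suc (toℕ j) ≡ 0 ⊎ suc (suc (toℕ j)) ≡ length (y ∷ ws)
        to e with suc (toℕ j) ℕ.≟ length ws
        ... | yes last = inj₂ (cong suc last)
        ... | no ¬last = contradiction (inj₂ e) (towards-init tw j ¬last)
        from : suc (toℕ j) ≡ 0 ⊎ suc (suc (toℕ j)) ≡ length (y ∷ ws) → E u (lookup ws j)
        from (inj₁ ())
        from (inj₂ last) = subst (E u) (sym (towards-last tw j (suc-injective last))) ux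

    cycle-adjacent : InducedPath (y ∷ ws) → ∀ i j →
                     E (lookup (u ∷ y ∷ ws) i) (lookup (u ∷ y ∷ ws) j) ⇔ CycAdj i j
    cycle-adjacent _ zero    zero    = mk⇔ (⊥-elim ∘ E-irrefl) λ
      { (inj₁ ()) ; (inj₂ (inj₁ ())) ; (inj₂ (inj₂ (inj₁ (_ , ())))) ; (inj₂ (inj₂ (inj₂ (_ , ())))) }
    cycle-adjacent _ zero    (suc j) = apex-adjacent j
    cycle-adjacent _ (suc i) zero    = mk⇔ (CycAdj-sym ∘ to ∘ E-sym) (E-sym ∘ from ∘ CycAdj-sym)
      where open Equivalence (apex-adjacent i)
    cycle-adjacent p (suc i) (suc j) = PathAdj⇔CycAdj-suc ⇔-∘ path-adjacent p i j

    close : ∀ {Vt} → InducedPath (y ∷ ws) → All Vt (u ∷ y ∷ ws) → CycleThrough Vt x u y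
    close p vs = u ∷ y ∷ ws , (long tw , (E⇒≢ uy ∷ apart tw) ∷ path-unique p , vs , adjacency) ,
                 there (there (towards-∈ tw)) , here refl , there (here refl)
      where
      long : ∀ {P ws} → Towards P x ws → 3 ℕ.≤ length (u ∷ y ∷ ws)
      long [-]     = s≤s (s≤s (s≤s z≤n))
      long (_ ∷ _) = s≤s (s≤s (s≤s z≤n))
      apart : ∀ {ws} → Towards (¬_ ∘ Touches u) x ws → All (u ≢_) ws
      apart [-]        = E⇒≢ ux ∷ []
      apart (far ∷ tw) = ¬Touches⇒≢ far ∷ apart tw
      adjacency : ∀ i j → (E (lookup (u ∷ y ∷ ws) i) (lookup (u ∷ y ∷ ws) j) → CycAdj i j) ×
                          (CycAdj i j → E (lookup (u ∷ y ∷ ws) i) (lookup (u ∷ y ∷ ws) j))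
      adjacency i j = Equivalence.to (cycle-adjacent p i j) , Equivalence.from (cycle-adjacent p i j)

  module _ (E? : ∀ a b → Dec (E a b)) where

    touches? : ∀ v z → Dec (Touches v z)
    touches? v z = (z Fin.≟ v) ⊎-dec E? v z

    last-touch : ∀ {P x} c {vs} → InducedPath vs → Towards P x vs → Any (Touches c) vs →
                 ∃₂ λ w ws → InducedPath (w ∷ ws) × Towards P x (w ∷ ws) ×
                             Touches c w × All (¬_ ∘ Touches c) ws
    last-touch c {v ∷ ws} p tw hit with any? (touches? c) ws
    last-touch c {v ∷ []}    _            _        _   | yes ()
    last-touch c {v ∷ _ ∷ _} (link _ _ p) (_ ∷ tw) _   | yes hit′ = last-touch c p tw hit′
    last-touch c {v ∷ ws}    p            tw       hit | no miss  =
      v , ws , p , tw , touch hit , ¬Any⇒All¬ ws miss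
      where
      touch : Any (Touches c) (v ∷ ws) → Touches c v
      touch (here t)  = t
      touch (there t) = contradiction t miss

    shortcut : ∀ {P x c v vs} → E c v → InducedPath (v ∷ vs) → Towards P x (v ∷ vs) →
               ∃ λ ws → InducedPath (c ∷ ws) × (Towards P x (c ∷ ws) ⊎ Towards P x ws)
    shortcut {c = c} cv p tw with last-touch c p tw (here (inj₂ cv))
    ... | _ , ws , p′ , tw′ , inj₁ refl , _    = ws , p′ , inj₁ tw′
    ... | w , ws , p′ , tw′ , inj₂ cw   , miss = w ∷ ws , link cw miss p′ , inj₂ tw′

  module _ (Vt Ok : Fin n → Set) (R : Fin n → Fin n → Set) (u : Fin n)
           (away⇒Ok : ∀ {v} → Vt v → ¬ Touches u v → Ok v)
           (R-refl : ∀ {a} → Ok a → R a a)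
           (R-step : ∀ {a b c} → R a b → E b c → Ok c → R a c)
           (R-sym : ∀ {a b} → R a b → R b a) where

    Arc : Fin n → Fin n → Set
    Arc x y = ∃₂ λ s t → E x s × R s t × E t y

    Arc-sym : ∀ {x y} → Arc x y → Arc y x
    Arc-sym (s , t , xs , st , ty) = t , s , E-sym ty , R-sym st , E-sym xs

    module OnCycle {k} (c : Fin (suc k) → Fin n) (c-injective : ∀ {i j} → c i ≡ c j → i ≡ j)
                   (adjacency : ∀ i j → (E (c i) (c j) → CycAdj i j) × (CycAdj i j → E (c i) (c j)))
                   (c-vertex : ∀ i → Vt (c i)) {pu : Fin (suc k)} (c-pu : c pu ≡ u) where

      edge⇒next : ∀ {i j} → E (c i) (c j) → next i ≡ j ⊎ next j ≡ i
      edge⇒next {i} {j} = CycAdj⇒next ∘ proj₁ (adjacency i j)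

      edge-next : ∀ i → E (c i) (c (next i))
      edge-next i = proj₂ (adjacency i (next i)) (CycAdj-next i)

      next-≢ : ∀ i → next i ≢ i
      next-≢ i eq = E-irrefl (subst (E (c i) ∘ c) eq (edge-next i))

      -- Walk forward from the successor of pb; every position other than pa, pu, pb lies
      -- away from u, so the walk stays inside Ok until it reaches the predecessor of pa.
      module _ {pa pb} (pa→pu : next pa ≡ pu) (pu→pb : next pu ≡ pb)
               (pa≢pb : pa ≢ pb) (b≁a : ¬ E (c pb) (c pa)) where

        Marked : Fin (suc k) → Set
        Marked j = j ≡ pa ⊎ j ≡ pu ⊎ j ≡ pb

        marked? : ∀ j → Dec (Marked j)
        marked? j = (j Fin.≟ pa) ⊎-dec (j Fin.≟ pu) ⊎-dec (j Fin.≟ pb)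

        unmarked-Ok : ∀ {j} → ¬ Marked j → Ok (c j)
        unmarked-Ok {j} ¬m = away⇒Ok (c-vertex j) λ
          { (inj₁ cj≡u) → ¬m (inj₂ (inj₁ (c-injective (trans cj≡u (sym c-pu)))))
          ; (inj₂ u~cj) → ¬m (neighbour (edge⇒next (subst (λ v → E v (c j)) (sym c-pu) u~cj))) }
          where
          neighbour : next pu ≡ j ⊎ next j ≡ pu → Marked j
          neighbour (inj₁ pu→j) = inj₂ (inj₂ (trans (sym pu→j) pu→pb))
          neighbour (inj₂ j→pu) = inj₁ (next-injective (trans j→pu (sym pa→pu)))

        s t : Fin (suc k)
        s = next pb
        t = prev pa

        s-unmarked : ¬ Marked s
        s-unmarked (inj₁ s≡pa)        = b≁a (subst (E (c pb) ∘ c) s≡pa (edge-next pb))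
        s-unmarked (inj₂ (inj₁ s≡pu)) = pa≢pb (next-injective (trans pa→pu (sym s≡pu)))
        s-unmarked (inj₂ (inj₂ s≡pb)) = next-≢ pb s≡pb

        t-unmarked : ¬ Marked t
        t-unmarked (inj₁ t≡pa)        = next-≢ pa (trans (cong next (sym t≡pa)) (next-prev pa))
        t-unmarked (inj₂ (inj₁ t≡pu)) = pa≢pb (trans (sym (next-prev pa)) (trans (cong next t≡pu) pu→pb))
        t-unmarked (inj₂ (inj₂ t≡pb)) =
          b≁a (subst (E (c pb) ∘ c) (trans (cong next (sym t≡pb)) (next-prev pa)) (edge-next pb))

        Reached : Fin (suc k) → Set
        Reached j = Marked j ⊎ R (c s) (c j)

        reached-next : ∀ j → Reached j → Reached (next j)
        reached-next _ (inj₁ (inj₁ refl))        = inj₁ (inj₂ (inj₁ pa→pu))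
        reached-next _ (inj₁ (inj₂ (inj₁ refl))) = inj₁ (inj₂ (inj₂ pu→pb))
        reached-next _ (inj₁ (inj₂ (inj₂ refl))) = inj₂ (R-refl (unmarked-Ok s-unmarked))
        reached-next j (inj₂ r) with marked? (next j)
        ... | yes m  = inj₁ m
        ... | no ¬m  = inj₂ (R-step r (edge-next j) (unmarked-Ok ¬m))

        arc-forward : Arc (c pb) (c pa)
        arc-forward with next-induction Reached (inj₁ (inj₁ refl)) reached-next t
        ... | inj₁ m = contradiction m t-unmarked
        ... | inj₂ r = c s , c t , edge-next pb , r , subst (E (c t) ∘ c) (next-prev pa) (edge-next t)

      arc : ∀ {px py x y} → c px ≡ x → c py ≡ y → E x u → E u y → x ≢ y → ¬ E x y → Arc x y
      arc {px} {py} refl refl xu uy x≢y x≁y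
        with edge⇒next (subst (E (c px)) (sym c-pu) xu)
           | edge⇒next (subst (λ v → E v (c py)) (sym c-pu) uy)
      ... | inj₁ px→pu | inj₁ pu→py = Arc-sym (arc-forward px→pu pu→py (x≢y ∘ cong c) (x≁y ∘ E-sym))
      ... | inj₁ px→pu | inj₂ py→pu = contradiction (cong c (next-injective (trans px→pu (sym py→pu)))) x≢y
      ... | inj₂ pu→px | inj₁ pu→py = contradiction (cong c (trans (sym pu→px) pu→py)) x≢y
      ... | inj₂ pu→px | inj₂ py→pu = arc-forward py→pu pu→px (x≢y ∘ sym ∘ cong c) x≁y

    cycle⇒arc : ∀ {x y} → CycleThrough Vt x u y → E x u → E u y → x ≢ y → ¬ E x y → Arc x y
    cycle⇒arc ([] , (() , _) , _)
    cycle⇒arc (cs@(_ ∷ _) , (_ , uniq , vs , adjacency) , x∈ , u∈ , y∈) =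
      OnCycle.arc (lookup cs) (lookup-injective uniq) adjacency (λ i → All.lookup vs (∈-lookup i))
                  {Any.index u∈} (position u∈) {Any.index x∈} {Any.index y∈} (position x∈) (position y∈)
      where
      position : ∀ {v} (v∈ : v ∈ cs) → lookup cs (Any.index v∈) ≡ v
      position v∈ = sym (lookup-index v∈)

least : ∀ {m} {D : Fin m → Set} → (∀ j → Dec (D j)) → ∀ {j} → D j →
        ∃ λ i → D i × (∀ {j} → D j → i ≤ j)
least {suc m} D? Dj with D? zero
... | yes D0 = zero , D0 , λ _ → z≤n
least {suc m} D? {zero}  Dj | no ¬D0 = contradiction Dj ¬D0
least {suc m} {D} D? {suc j} Dj | no ¬D0 with least (D? ∘ suc) Dj
... | i , Di , i-least = suc i , Di , above
  where
  above : ∀ {j} → D j → suc i ≤ j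
  above {zero}  D0  = contradiction D0 ¬D0
  above {suc j} Dsj = s≤s (i-least Dsj)

module _ {n : ℕ} (G : Graph n) (u : Fin n) where

  edge-sym : ∀ {a b} → Edge G a b → Edge G b a
  edge-sym {a} {b} = subst T (Graph.sym G a b)

  edge-irrefl : ∀ {a} → ¬ Edge G a a
  edge-irrefl {a} = subst T (Graph.irrefl G a)

  edge? : ∀ a b → Dec (Edge G a b)
  edge? a b = T? (adj G a b)

  module InG = Cycles (Edge G) edge-sym edge-irrefl

  outside? : ∀ a → Dec (Outside G u a)
  outside? a = ¬? (InG.touches? edge? u a)

  reach-outsideˡ : ∀ {a b} → Reach G u a b → Outside G u a
  reach-outsideˡ (here o)     = o
  reach-outsideˡ (step r _ _) = reach-outsideˡ r

  reach-outsideʳ : ∀ {a b} → Reach G u a b → Outside G u b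
  reach-outsideʳ (here o)     = o
  reach-outsideʳ (step _ _ o) = o

  reach-trans : ∀ {a b c} → Reach G u a b → Reach G u b c → Reach G u a c
  reach-trans r (here _)      = r
  reach-trans r (step r′ e o) = step (reach-trans r r′) e o

  reach-sym : ∀ {a b} → Reach G u a b → Reach G u b a
  reach-sym (here o)     = here o
  reach-sym (step r e o) = reach-trans (step (here o) (edge-sym e) (reach-outsideʳ r)) (reach-sym r)

  -- Rep G u selects the least vertex of a component, so reachability in G − N[u] has to be
  -- decided. ReachVia L is Floyd–Warshall: reachability using only vertices of L as joints.
  ReachVia : List (Fin n) → Fin n → Fin n → Set
  ReachVia []      a c = Outside G u a × Outside G u c × InG.Touches a c
  ReachVia (v ∷ L) a c = ReachVia L a c ⊎ (ReachVia L a v × ReachVia L v c)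

  reachVia? : ∀ L a c → Dec (ReachVia L a c)
  reachVia? []      a c = outside? a ×-dec outside? c ×-dec InG.touches? edge? a c
  reachVia? (v ∷ L) a c = reachVia? L a c ⊎-dec (reachVia? L a v ×-dec reachVia? L v c)

  via-base : ∀ L {a c} → Outside G u a → Outside G u c → InG.Touches a c → ReachVia L a c
  via-base []      oa oc t = oa , oc , t
  via-base (_ ∷ L) oa oc t = inj₁ (via-base L oa oc t)

  via-join : ∀ L {a b c} → ReachVia L a b → ReachVia L b c → b ∈ L → ReachVia L a c
  via-join (v ∷ L) ab bc (here refl) = inj₂ (into ab , out-of bc)
    where
    into : ∀ {a} → ReachVia (v ∷ L) a v → ReachVia L a v
    into (inj₁ r)       = r
    into (inj₂ (r , _)) = r
    out-of : ∀ {c} → ReachVia (v ∷ L) v c → ReachVia L v c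
    out-of (inj₁ r)       = r
    out-of (inj₂ (_ , r)) = r
  via-join (v ∷ L) (inj₁ ab)        (inj₁ bc)        (there b∈) = inj₁ (via-join L ab bc b∈)
  via-join (v ∷ L) (inj₁ ab)        (inj₂ (bv , vc)) (there b∈) = inj₂ (via-join L ab bv b∈ , vc)
  via-join (v ∷ L) (inj₂ (av , vb)) (inj₁ bc)        (there b∈) = inj₂ (av , via-join L vb bc b∈)
  via-join (v ∷ L) (inj₂ (av , _))  (inj₂ (_ , vc))  (there _)  = inj₂ (av , vc)

  via-sound : ∀ L {a c} → ReachVia L a c → Reach G u a c
  via-sound []      (oa , _  , inj₁ refl) = here oa
  via-sound []      (oa , oc , inj₂ e)    = step (here oa) e oc
  via-sound (_ ∷ L) (inj₁ r)              = via-sound L r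
  via-sound (_ ∷ L) (inj₂ (r , r′))       = reach-trans (via-sound L r) (via-sound L r′)

  via-complete : ∀ {a c} → Reach G u a c → ReachVia (allFin n) a c
  via-complete (here o)     = via-base (allFin n) o o (inj₁ refl)
  via-complete (step r e o) =
    via-join (allFin n) (via-complete r) (via-base (allFin n) (reach-outsideʳ r) o (inj₂ e)) (∈-allFin _)

  reach? : ∀ a c → Dec (Reach G u a c)
  reach? a c = map′ (via-sound (allFin n)) via-complete (reachVia? (allFin n) a c)

  representative : ∀ {a} → Outside G u a → ∃ λ w → Rep G u w × Reach G u w a
  representative o with least (reach? _) (here o)
  ... | w , aw , w-least = w , (reach-outsideʳ aw , λ _ ww′ → w-least (reach-trans aw ww′)) , reach-sym aw

  Detour : Fin n → Fin n → Set
  Detour x y = ∃₂ λ a b → Edge G x a × Reach G u a b × Edge G b y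

  cycle⇒detour : ∀ {x y} → Edge G u x → Edge G u y → x ≢ y → ¬ Edge G x y →
                 InG.CycleThrough FullV x u y → Detour x y
  cycle⇒detour ux uy x≢y x≁y cyc =
    InG.cycle⇒arc FullV (Outside G u) (Reach G u) u (λ _ far → far) here step reach-sym
                  cyc (edge-sym ux) uy x≢y x≁y

  induced-path : ∀ {x a v} → Edge G x a → Reach G u a v →
                 ∃ λ ws → InG.InducedPath (v ∷ ws) × InG.Towards (Outside G u) x (v ∷ ws)
  induced-path {x} xa (here o) = x ∷ [] , InG.link (edge-sym xa) [] InG.[-] , o InG.∷ InG.[-]
  induced-path xa (step r e o) with induced-path xa r
  ... | _ , p , tw with InG.shortcut edge? (edge-sym e) p tw
  ...   | ws , p′ , inj₁ tw′ = ws , p′ , tw′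
  ...   | ws , p′ , inj₂ tw′ = ws , p′ , o InG.∷ tw′

  detour⇒cycle : ∀ {x y} → Edge G u x → Edge G u y → x ≢ y → Detour x y → InG.CycleThrough FullV x u y
  detour⇒cycle {y = y} ux uy x≢y (_ , _ , xa , ab , by) with induced-path xa ab
  ... | _ , p , tw with InG.shortcut edge? (edge-sym by) p tw
  ...   | _  , _  , inj₁ InG.[-]         = contradiction refl x≢y
  ...   | _  , _  , inj₁ (y-out InG.∷ _) = contradiction (inj₂ uy) y-out
  ...   | ws , p′ , inj₂ tw′             = InG.close uy ux tw′ p′ (All.universal _ (u ∷ y ∷ ws))

  edgeᵁ-sym : ∀ {a b} → EdgeU G u a b → EdgeU G u b a
  edgeᵁ-sym (inj₁ (ca , cb , e))                  = inj₁ (cb , ca , edge-sym e)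
  edgeᵁ-sym (inj₂ (inj₁ (ra , ub , z , az , zb))) = inj₂ (inj₂ (ra , ub , z , az , edge-sym zb))
  edgeᵁ-sym (inj₂ (inj₂ (rb , ua , z , bz , az))) = inj₂ (inj₁ (rb , ua , z , bz , edge-sym az))

  edgeᵁ-irrefl : ∀ {a} → ¬ EdgeU G u a a
  edgeᵁ-irrefl (inj₁ (_ , _ , e))          = edge-irrefl e
  edgeᵁ-irrefl (inj₂ (inj₁ (ra , ua , _))) = proj₁ ra (inj₂ ua)
  edgeᵁ-irrefl (inj₂ (inj₂ (ra , ua , _))) = proj₁ ra (inj₂ ua)

  module InGᵤ = Cycles (EdgeU G u) edgeᵁ-sym edgeᵁ-irrefl

  spokeᵁ : ∀ {v} → Edge G u v → EdgeU G u u v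
  spokeᵁ uv = inj₁ (inj₁ refl , inj₂ uv , uv)

  neighbourᵁ : ∀ {v} → EdgeU G u u v → Edge G u v
  neighbourᵁ (inj₁ (_ , _ , e))         = e
  neighbourᵁ (inj₂ (inj₁ (ru , _ , _))) = contradiction (inj₁ refl) (proj₁ ru)
  neighbourᵁ (inj₂ (inj₂ (_ , uu , _))) = contradiction uu edge-irrefl

  edgeᵁ-within-N : ∀ {x y} → Edge G u x → Edge G u y → EdgeU G u x y → Edge G x y
  edgeᵁ-within-N _  _  (inj₁ (_ , _ , e))         = e
  edgeᵁ-within-N ux _  (inj₂ (inj₁ (rx , _ , _))) = contradiction (inj₂ ux) (proj₁ rx)
  edgeᵁ-within-N _  uy (inj₂ (inj₂ (ry , _ , _))) = contradiction (inj₂ uy) (proj₁ ry)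

  no-edgeᵁ-outside : ∀ {a b} → Outside G u a → Outside G u b → ¬ EdgeU G u a b
  no-edgeᵁ-outside oa _  (inj₁ (ca , _ , _))        = oa ca
  no-edgeᵁ-outside _  ob (inj₂ (inj₁ (_ , ub , _))) = ob (inj₂ ub)
  no-edgeᵁ-outside oa _  (inj₂ (inj₂ (_ , ua , _))) = oa (inj₂ ua)

  edgeᵁ-to-outside : ∀ {x s} → Edge G u x → Outside G u s → EdgeU G u x s →
                     ∃ λ z → Edge G x z × Reach G u s z
  edgeᵁ-to-outside _  os (inj₁ (_ , cs , _))                 = contradiction cs os
  edgeᵁ-to-outside ux _  (inj₂ (inj₁ (rx , _ , _)))          = contradiction (inj₂ ux) (proj₁ rx)
  edgeᵁ-to-outside _  _  (inj₂ (inj₂ (_ , _ , z , sz , xz))) = z , xz , sz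

  away-from-u : ∀ {v} → VertU G u v → ¬ InGᵤ.Touches u v → Outside G u v
  away-from-u (inj₁ v≡u)        far = contradiction (inj₁ v≡u) far
  away-from-u (inj₂ (inj₁ uv))  far = contradiction (inj₂ (spokeᵁ uv)) far
  away-from-u (inj₂ (inj₂ rep)) _   = proj₁ rep

  -- G_u has no edges outside N[u], so the arc never steps; unfolding its two contracted end
  -- vertices gives the detour.
  cycleᵁ⇒detour : ∀ {x y} → Edge G u x → Edge G u y → x ≢ y → ¬ Edge G x y →
                  InGᵤ.CycleThrough (VertU G u) x u y → Detour x y
  cycleᵁ⇒detour ux uy x≢y x≁y cyc
    with InGᵤ.cycle⇒arc (VertU G u) (Outside G u) (Reach G u) u away-from-u here
           (λ r e o → contradiction e (no-edgeᵁ-outside (reach-outsideʳ r) o)) reach-sym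
           cyc (edgeᵁ-sym (spokeᵁ ux)) (spokeᵁ uy)
           x≢y (x≁y ∘ edgeᵁ-within-N ux uy)
  ... | s , t , xs , st , ty
    with edgeᵁ-to-outside ux (reach-outsideˡ st) xs
       | edgeᵁ-to-outside uy (reach-outsideʳ st) (edgeᵁ-sym ty)
  ... | z , xz , sz | z′ , yz′ , tz′ =
    z , z′ , xz , reach-trans (reach-trans (reach-sym sz) st) tz′ , edge-sym yz′

  detour⇒cycleᵁ : ∀ {x y} → Edge G u x → Edge G u y → x ≢ y → ¬ Edge G x y →
                  Detour x y → InGᵤ.CycleThrough (VertU G u) x u y
  detour⇒cycleᵁ {x} {y} ux uy x≢y x≁y (a , b , xa , ab , by) with representative (reach-outsideˡ ab)
  ... | w , rep , wa =
    InGᵤ.close (spokeᵁ uy) (spokeᵁ ux) (w-away InGᵤ.∷ InGᵤ.[-])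
               (InGᵤ.link (edgeᵁ-sym wy) (y-far-x ∷ []) (InGᵤ.link (edgeᵁ-sym xw) [] InGᵤ.[-]))
               (inj₁ refl ∷ inj₂ (inj₁ uy) ∷ inj₂ (inj₂ rep) ∷ inj₂ (inj₁ ux) ∷ [])
    where
    xw : EdgeU G u x w
    xw = inj₂ (inj₂ (rep , ux , a , wa , xa))
    wy : EdgeU G u w y
    wy = inj₂ (inj₁ (rep , uy , b , reach-trans wa ab , by))
    w-away : ¬ InGᵤ.Touches u w
    w-away (inj₁ w≡u) = proj₁ rep (inj₁ w≡u)
    w-away (inj₂ uw)  = proj₁ rep (inj₂ (neighbourᵁ uw))
    y-far-x : ¬ InGᵤ.Touches y x
    y-far-x (inj₁ x≡y) = x≢y x≡y
    y-far-x (inj₂ yx)  = x≁y (edgeᵁ-within-N ux uy (edgeᵁ-sym yx))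

  cycles⇔ : ∀ {x y} → Edge G u x → Edge G u y → x ≢ y → ¬ Edge G x y →
            InG.CycleThrough FullV x u y ⇔ InGᵤ.CycleThrough (VertU G u) x u y
  cycles⇔ ux uy x≢y x≁y = mk⇔ (detour⇒cycleᵁ ux uy x≢y x≁y ∘ cycle⇒detour ux uy x≢y x≁y)
                              (detour⇒cycle ux uy x≢y ∘ cycleᵁ⇒detour ux uy x≢y x≁y)

lemma23 : ∀ (n : ℕ) (G : Graph n) (u : Fin n) →
    Avoidable FullV (Edge G) u ⇔ Avoidable (VertU G u) (EdgeU G u) u
lemma23 n G u = mk⇔ to from
  where
  to : Avoidable FullV (Edge G) u → Avoidable (VertU G u) (EdgeU G u) u
  to avoid x y _ _ xuᵁ uyᵁ x≢y x≁yᵁ =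
    Equivalence.to (cycles⇔ G u ux uy x≢y x≁y) (avoid x y tt tt (edge-sym G u ux) uy x≢y x≁y)
    where
    ux : Edge G u x
    ux = neighbourᵁ G u (edgeᵁ-sym G u xuᵁ)
    uy : Edge G u y
    uy = neighbourᵁ G u uyᵁ
    x≁y : ¬ Edge G x y
    x≁y xy = x≁yᵁ (inj₁ (inj₂ ux , inj₂ uy , xy))
  from : Avoidable (VertU G u) (EdgeU G u) u → Avoidable FullV (Edge G) u
  from avoid x y _ _ xu uy x≢y x≁y =
    Equivalence.from (cycles⇔ G u ux uy x≢y x≁y)
      (avoid x y (inj₂ (inj₁ ux)) (inj₂ (inj₁ uy)) (edgeᵁ-sym G u (spokeᵁ G u ux)) (spokeᵁ G u uy)
             x≢y (x≁y ∘ edgeᵁ-within-N G u ux uy))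
    where
    ux : Edge G u x
    ux = edge-sym G u xu
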